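{- Let $n\in\mathbb{N}$, $l\in\mathbb{Z}$, $k\in[0,n]$, let $H=(V(H),E(H))$ be an induced subgraph of $\mathcal{KG}(n,k,l)$, and let $\pi=(a_1\,a_2)\cdots(a_{2t-1}\,a_{2t})\in\Sigma_n$ be a permutation of order $2$, with $a_1,\dots,a_{2t}\in[1,n]$ distinct. Define $\varphi_\pi$ on $k$-subsets by $\varphi_\pi(\{b_1,\dots,b_k\})=\{\pi(b_1),\dots,\pi(b_k)\}$. If (a) $\varphi_\pi(V(H))=V(H)$ and (b) $t<k-l$, then ${\rm Nim}(H)={\rm Nim}(H')$, where $H'$ is the induced subgraph of $H$ with vertex set $\{u\in V(H) : a_{2i+1}\in u \Leftrightarrow a_{2i+2}\in u \text{ for all } i\in[0,t-1]\}$.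
   Context: Chomp on a finite poset $P$ with global minimum $0$: two players alternately pick an element $x$ of the remaining poset and remove all elements $\ge x$; the player forced to pick $0$ loses. ${\rm Nim}(\{0\})=0$ and ${\rm Nim}(P)=\mathrm{mex}\{{\rm Nim}(P_x) : x\in P\setminus\{0\}\}$, where $P_x$ is $P$ with the up-set of $x$ removed. A finite graph is regarded as the poset of the empty set, its vertices and its edges ordered by inclusion. For $(n,k,l)\in\mathbb{N}\times\mathbb{Z}^2$, $\mathcal{KG}(n,k,l)$ has as vertices the $k$-element subsets of $[1,n]=\{1,\dots,n\}$, two distinct vertices adjacent iff the sets intersect in at most $l$ elements. -}

module Defs where

open import Data.Nat using (ℕ; zero; suc)
open import Data.Bool using (Bool; true; false; not; _∧_; _∨_; _xor_; if_then_else_)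
import Data.Bool.Properties as BoolP
open import Data.List using (List; []; _∷_; map; filter; length; _++_; filterᵇ)
open import Data.Bool.ListAction using (any; all)
open import Data.Vec using (Vec; []; _∷_; lookup; tabulate)
open import Data.Vec.Properties using (≡-dec)
open import Data.Fin using (Fin; _≟_)
open import Data.Fin.Subset using (Subset; ∣_∣; _∩_)
open import Data.Integer using (ℤ; +_; _≤ᵇ_)
open import Data.Product using (_×_; ∃)
open import Relation.Nullary.Decidable using (⌊_⌋)
open import Relation.Binary.PropositionalEquality using (_≡_)
import Data.Nat as ℕ
import Data.List as L

_∈ᵇ_ : ℕ → List ℕ → Bool
m ∈ᵇ xs = any (λ x → ⌊ m ℕ.≟ x ⌋) xs

-- search from m for at most f steps; with f = 1 + length xs the answer is found
mexSearch : ℕ → ℕ → List ℕ → ℕ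
mexSearch zero    m xs = m
mexSearch (suc f) m xs = if m ∈ᵇ xs then mexSearch f (suc m) xs else m

mex : List ℕ → ℕ
mex xs = mexSearch (suc (length xs)) 0 xs

-- A finite poset is given by: a list of its (distinct) elements, a
-- boolean order relation leq, and a test isBot for the global minimum 0.
-- A position is the list of remaining elements; choosing x ≠ 0 removes
-- all y with x ≤ y.  Nim is computed with fuel (each move removes at
-- least x itself, so fuel = number of elements suffices).

module Chomp {A : Set} (leq : A → A → Bool) (isBot : A → Bool) where

  move : A → List A → List A
  move x P = filterᵇ (λ y → not (leq x y)) P

  nimF : ℕ → List A → ℕ
  nimF zero    P = 0
  nimF (suc f) P = mex (map (λ x → nimF f (move x P)) (filterᵇ (λ x → not (isBot x)) P))

  Nim : List A → ℕ
  Nim P = nimF (length P) P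

-- The poset of a finite graph whose vertices are subsets of [1,n]
-- (encoded as Fin n): elements are the empty set, the vertices and the
-- edges, ordered by inclusion.

data GElem (n : ℕ) : Set where
  bot : GElem n
  vtx : Subset n → GElem n
  edg : Subset n → Subset n → GElem n

_≟ˢ_ : ∀ {n} → Subset n → Subset n → Bool
u ≟ˢ v = ⌊ ≡-dec BoolP._≟_ u v ⌋

-- inclusion order (an edge edg u v stands for the set {u , v})
leqG : ∀ {n} → GElem n → GElem n → Bool
leqG bot       _         = true
leqG (vtx u)   bot       = false
leqG (vtx u)   (vtx v)   = u ≟ˢ v
leqG (vtx w)   (edg u v) = (w ≟ˢ u) ∨ (w ≟ˢ v)
leqG (edg _ _) bot       = false
leqG (edg _ _) (vtx _)   = false
leqG (edg u v) (edg u' v') = (u ≟ˢ u') ∧ (v ≟ˢ v')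

isBotG : ∀ {n} → GElem n → Bool
isBotG bot = true
isBotG _   = false

pairs : ∀ {B : Set} → List B → List (B × B)
pairs []       = []
pairs (x ∷ xs) = map (x Data.Product.,_) xs ++ pairs xs

-- poset of the graph with vertex list vs (no repetitions) and adjacency adj
graphPoset : ∀ {n} → List (Subset n) → (Subset n → Subset n → Bool) → List (GElem n)
graphPoset vs adj =
  bot ∷ map vtx vs ++ map (λ p → edg (Data.Product.proj₁ p) (Data.Product.proj₂ p))
                          (filterᵇ (λ p → adj (Data.Product.proj₁ p) (Data.Product.proj₂ p)) (pairs vs))

NimGraph : ∀ {n} → List (Subset n) → (Subset n → Subset n → Bool) → ℕ
NimGraph vs adj = Chomp.Nim leqG isBotG (graphPoset vs adj)

allSubsets : ∀ n → List (Subset n)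
allSubsets zero    = [] ∷ []
allSubsets (suc n) = map (true ∷_) (allSubsets n) ++ map (false ∷_) (allSubsets n)

adjKG : ∀ {n} → ℤ → Subset n → Subset n → Bool
adjKG l u v = not (u ≟ˢ v) ∧ ((+ ∣ u ∩ v ∣) ≤ᵇ l)

vertsKG : ∀ n → ℕ → (Subset n → Bool) → List (Subset n)
vertsKG n k inV = filterᵇ (λ u → ⌊ ∣ u ∣ ℕ.≟ k ⌋ ∧ inV u) (allSubsets n)

NimKG : ∀ n → ℕ → ℤ → (Subset n → Bool) → ℕ
NimKG n k l inV = NimGraph (vertsKG n k inV) (adjKG l)

InV : ∀ {n} → ℕ → (Subset n → Bool) → Subset n → Set
InV k inV u = (∣ u ∣ ≡ k) × (inV u ≡ true)

-- The involution π = (b₀ c₀)(b₁ c₁)⋯(b_{t-1} c_{t-1}) and φ_π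
-- (b i = a_{2i+1}, c i = a_{2i+2})

transp : ∀ {n} → Fin n → Fin n → Fin n → Fin n
transp x y z = if ⌊ z ≟ x ⌋ then y else (if ⌊ z ≟ y ⌋ then x else z)

perm : ∀ {n t} → (Fin t → Fin n) → (Fin t → Fin n) → Fin n → Fin n
perm {t = t} b c z = L.foldr (λ i w → transp (b i) (c i) w) z (L.allFin t)

image : ∀ {n} → (Fin n → Fin n) → Subset n → Subset n
image {n} f u = tabulate (λ j → any (λ x → lookup u x ∧ ⌊ f x ≟ j ⌋) (L.allFin n))

pairedᵇ : ∀ {n t} → (Fin t → Fin n) → (Fin t → Fin n) → Subset n → Bool
pairedᵇ {t = t} b c u = all (λ i → not (lookup u (b i) xor lookup u (c i))) (L.allFin t)

-- Since φ_π is an involution mapping V(H) into itself, it is an automorphism of H of order 2,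
-- and no vertex u is adjacent to φ_π(u): u and φ_π(u) differ in at most t of their k elements,
-- so |u ∩ φ_π(u)| ≥ k − t > l.  It therefore induces an order-preserving involution τ of the Chomp
-- poset of H.  The poset of H′ (∅, the vertices of H′ and the edges between them) consists of
-- τ-fixed elements, is a down-set, and no element x outside it lies below τ x.  In a τ-invariant
-- position, moves into H′ correspond to the moves of the position restricted to H′, while a move
-- x outside H′ can be answered by τ x, which leads back to a τ-invariant position with the same
-- restriction to H′.  By induction on the size of the position, every τ-invariant position has
-- the same Nim value as its restriction to H′; for the whole poset this is Nim(H) = Nim(H′).

module Submission where

open import Defs
open import Data.Nat using (ℕ; zero; suc; _≤_; _+_; _∸_; z≤n; s≤s)
import Data.Nat as ℕ
import Data.Nat.Properties as ℕP
open import Data.Integer using (ℤ; +_; _-_; _⊖_; _≤ᵇ_; _<_)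
import Data.Integer.Properties as ℤP
open import Data.Bool using (Bool; true; false; not; _∧_; _∨_; _xor_; T; T?)
import Data.Bool.Properties as BoolP
open import Data.Bool.ListAction using (any)
open import Data.List using (List; []; _∷_; length; map; filterᵇ; _++_)
import Data.List as List
import Data.List.Properties as ListP
open import Data.List.Relation.Unary.Any using (here; there; index)
import Data.List.Relation.Unary.Any as Any
open import Data.List.Relation.Unary.Any.Properties using (lookup-index)
import Data.List.Relation.Unary.Any.Properties as AnyP
import Data.List.Relation.Unary.All as All
import Data.List.Relation.Unary.All.Properties as AllP
open import Data.List.Relation.Unary.AllPairs using ([]; _∷_)
open import Data.List.Relation.Unary.Unique.Propositional using (Unique)
open import Data.List.Relation.Unary.Unique.Propositional.Properties using (allFin⁺)
import Data.List.Relation.Unary.Unique.Propositional.Properties as UniqueP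
open import Data.List.Membership.Propositional using (_∈_; _∉_)
open import Data.List.Membership.Propositional.Properties
  using (∈-map⁺; ∈-map⁻; ∈-filter⁺; ∈-filter⁻; ∈-++⁺ˡ; ∈-++⁺ʳ; ∈-++⁻; ∈-allFin)
open import Data.List.Relation.Binary.Subset.Propositional using (_⊆_)
import Data.Vec as Vec
open import Data.Vec using (Vec; []; _∷_; lookup)
open import Data.Vec.Properties
  using (≡-dec; lookup∘tabulate; tabulate∘lookup; tabulate-cong; lookup-zipWith; []=⇒lookup; lookup⇒[]=)
open import Data.Fin using (Fin; zero; suc; toℕ; _≟_)
import Data.Fin.Properties as FinP
open import Data.Fin.Subset using (Subset; ∣_∣; _∩_; _─_; ⊤; inside; outside) renaming (_∈_ to _∈ₛ_; _-_ to _-ₛ_)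
open import Data.Fin.Subset.Properties using (x∈p⇒∣p-x∣<∣p∣; x∈p∧x≢y⇒x∈p-y; ∣⊤∣≡n; ∈⊤; ∩-comm)
open import Data.Product using (_×_; _,_; proj₁; proj₂; ∃)
import Data.Product
import Data.Product.Properties
import Data.List.Membership.DecPropositional
open import Data.Sum using (_⊎_; inj₁; inj₂)
open import Data.Empty using (⊥-elim)
open import Function using (_∘_; Equivalence; _⇔_; mk⇔)
open import Function.Definitions using (Injective)
open import Relation.Nullary using (¬_; yes; no; Dec)
open import Relation.Nullary.Decidable using (⌊_⌋; _⊎-dec_; toWitness; fromWitness)
open import Relation.Binary.PropositionalEquality
open import Relation.Binary using (tri<; tri≈; tri>)

true≢false : true ≢ false
true≢false ()

∧-swapʳ : ∀ a b c → (a ∧ b) ∧ c ≡ (a ∧ c) ∧ b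
∧-swapʳ a b c = trans (BoolP.∧-assoc a b c) (trans (cong (a ∧_) (BoolP.∧-comm b c)) (sym (BoolP.∧-assoc a c b)))

∧≡true⁻ : ∀ {a b} → a ∧ b ≡ true → a ≡ true × b ≡ true
∧≡true⁻ {true} b≡true = refl , b≡true

≡-from-true⇔true : ∀ {a b} → (a ≡ true → b ≡ true) → (b ≡ true → a ≡ true) → a ≡ b
≡-from-true⇔true {true}  {true}  _  _  = refl
≡-from-true⇔true {true}  {false} a⇒b _  = sym (a⇒b refl)
≡-from-true⇔true {false} {true}  _  b⇒a = b⇒a refl
≡-from-true⇔true {false} {false} _  _  = refl

∈ᵇ⇒∈ : ∀ {m} xs → m ∈ᵇ xs ≡ true → m ∈ xs
∈ᵇ⇒∈ {m} xs h = Any.map toWitness (AnyP.any⁻ (λ x → ⌊ m ℕ.≟ x ⌋) xs (Equivalence.from BoolP.T-≡ h))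

∈⇒∈ᵇ : ∀ {m} xs → m ∈ xs → m ∈ᵇ xs ≡ true
∈⇒∈ᵇ {m} xs m∈ = Equivalence.to BoolP.T-≡ (AnyP.any⁺ (λ x → ⌊ m ℕ.≟ x ⌋) (Any.map fromWitness m∈))

MexSpec : List ℕ → ℕ → Set
MexSpec xs m = m ∉ xs × (∀ {j} → j ℕ.< m → j ∈ xs)

mexSearch-spec : ∀ f m xs → (∀ {j} → j ℕ.< m → j ∈ xs) →
  (∀ {j} → j ℕ.< mexSearch f m xs → j ∈ xs) × (mexSearch f m xs ∉ xs ⊎ mexSearch f m xs ≡ f + m)
mexSearch-spec zero    m xs below = below , inj₂ refl
mexSearch-spec (suc f) m xs below with m ∈ᵇ xs in m∈ᵇxs
... | false = below , inj₁ (λ m∈xs → true≢false (trans (sym (∈⇒∈ᵇ xs m∈xs)) m∈ᵇxs))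
... | true with mexSearch-spec f (suc m) xs below′
  where
  below′ : ∀ {j} → j ℕ.< suc m → j ∈ xs
  below′ {j} (s≤s j≤m) with ℕP.m≤n⇒m<n∨m≡n j≤m
  ... | inj₁ j<m  = below j<m
  ... | inj₂ refl = ∈ᵇ⇒∈ xs m∈ᵇxs
...   | below″ , inj₁ m∉ = below″ , inj₁ m∉
...   | below″ , inj₂ eq = below″ , inj₂ (trans eq (ℕP.+-suc f m))

prefix⊈ : ∀ xs → ¬ (∀ {j} → j ℕ.< suc (length xs) → j ∈ xs)
prefix⊈ xs all∈ = ℕP.<-irrefl refl (FinP.injective⇒≤ position-injective)
  where
  position : Fin (suc (length xs)) → Fin (length xs)
  position i = index (all∈ (FinP.toℕ<n i))
  position-injective : ∀ {i i′} → position i ≡ position i′ → i ≡ i′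
  position-injective {i} {i′} eq = FinP.toℕ-injective (begin
    toℕ i                             ≡⟨ lookup-index (all∈ (FinP.toℕ<n i)) ⟩
    List.lookup xs (position i)       ≡⟨ cong (List.lookup xs) eq ⟩
    List.lookup xs (position i′)      ≡⟨ lookup-index (all∈ (FinP.toℕ<n i′)) ⟨
    toℕ i′                            ∎)
    where open ≡-Reasoning

mex-spec : ∀ xs → MexSpec xs (mex xs)
mex-spec xs with mexSearch-spec (suc (length xs)) 0 xs (λ ())
... | below , inj₁ mex∉ = mex∉ , below
... | below , inj₂ eq   =
  ⊥-elim (prefix⊈ xs (λ j< → below (subst (_ ℕ.<_) (sym (trans eq (ℕP.+-identityʳ _))) j<)))

mex-≡ : ∀ {xs ys} → ys ⊆ xs → mex ys ∉ xs → mex xs ≡ mex ys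
mex-≡ {xs} {ys} ys⊆xs mexys∉xs with ℕP.<-cmp (mex xs) (mex ys)
... | tri< lt _ _ = ⊥-elim (proj₁ (mex-spec xs) (ys⊆xs (proj₂ (mex-spec ys) lt)))
... | tri≈ _ eq _ = eq
... | tri> _ _ gt = ⊥-elim (mexys∉xs (proj₂ (mex-spec xs) gt))

module _ {A : Set} where

  ∈-filterᵇ⁺ : ∀ (p : A → Bool) {x xs} → x ∈ xs → p x ≡ true → x ∈ filterᵇ p xs
  ∈-filterᵇ⁺ p x∈xs px = ∈-filter⁺ (T? ∘ p) x∈xs (Equivalence.from BoolP.T-≡ px)

  ∈-filterᵇ⁻ : ∀ (p : A → Bool) {x} xs → x ∈ filterᵇ p xs → x ∈ xs × p x ≡ true
  ∈-filterᵇ⁻ p xs x∈ = Data.Product.map₂ (Equivalence.to BoolP.T-≡) (∈-filter⁻ (T? ∘ p) x∈)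

  filterᵇ-filterᵇ : ∀ (p q : A → Bool) xs → filterᵇ p (filterᵇ q xs) ≡ filterᵇ (λ z → q z ∧ p z) xs
  filterᵇ-filterᵇ p q []       = refl
  filterᵇ-filterᵇ p q (x ∷ xs) with q x
  ... | false = filterᵇ-filterᵇ p q xs
  ... | true with p x
  ...   | true  = cong (x ∷_) (filterᵇ-filterᵇ p q xs)
  ...   | false = filterᵇ-filterᵇ p q xs

  filterᵇ-cong-local : ∀ {p p′ : A → Bool} xs → (∀ {z} → z ∈ xs → p z ≡ p′ z) → filterᵇ p xs ≡ filterᵇ p′ xs
  filterᵇ-cong-local {p} {p′} []       eq = refl
  filterᵇ-cong-local {p} {p′} (x ∷ xs) eq with p x | p′ x | eq (here refl)
  ... | true  | true  | _ = cong (x ∷_) (filterᵇ-cong-local xs (eq ∘ there))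
  ... | false | false | _ = filterᵇ-cong-local xs (eq ∘ there)

  filterᵇ-map : ∀ {B : Set} (p : B → Bool) (f : A → B) xs → filterᵇ p (map f xs) ≡ map f (filterᵇ (p ∘ f) xs)
  filterᵇ-map p f []       = refl
  filterᵇ-map p f (x ∷ xs) with p (f x)
  ... | true  = cong (f x ∷_) (filterᵇ-map p f xs)
  ... | false = filterᵇ-map p f xs

module ChompProperties {A : Set} (leq : A → A → Bool) (isBot : A → Bool)
                       (leq-refl : ∀ x → leq x x ≡ true) where

  open Chomp leq isBot

  options : List A → List ℕ
  options xs = map (λ x → Nim (move x xs)) (filterᵇ (not ∘ isBot) xs)

  option∈ : ∀ {x xs} → x ∈ xs → not (isBot x) ≡ true → Nim (move x xs) ∈ options xs
  option∈ {x} {xs} x∈ nonbot = ∈-map⁺ (λ y → Nim (move y xs)) (∈-filterᵇ⁺ (not ∘ isBot) x∈ nonbot)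

  ∈options⁻ : ∀ {j} xs → j ∈ options xs → ∃ λ x → x ∈ xs × not (isBot x) ≡ true × j ≡ Nim (move x xs)
  ∈options⁻ xs j∈ with ∈-map⁻ (λ y → Nim (move y xs)) j∈
  ... | x , x∈ , refl = x , proj₁ (∈-filterᵇ⁻ (not ∘ isBot) xs x∈) , proj₂ (∈-filterᵇ⁻ (not ∘ isBot) xs x∈) , refl

  move-shrinks : ∀ {x xs} → x ∈ xs → length (move x xs) ℕ.< length xs
  move-shrinks {x} {xs} x∈xs = ListP.filter-notAll (T? ∘ (not ∘ leq x)) xs (Any.map x∉move x∈xs)
    where
    x∉move : ∀ {y} → x ≡ y → ¬ T (not (leq x y))
    x∉move refl rewrite leq-refl x = λ ()

  nimF-fuel : ∀ f g xs → length xs ≤ f → length xs ≤ g → nimF f xs ≡ nimF g xs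
  nimF-fuel zero    zero    xs       _  _  = refl
  nimF-fuel zero    (suc g) []       _  _  = refl
  nimF-fuel (suc f) zero    []       _  _  = refl
  nimF-fuel (suc f) (suc g) xs       ≤f ≤g = cong mex (ListP.map-cong-local (All.tabulate same))
    where
    same : ∀ {x} → x ∈ filterᵇ (not ∘ isBot) xs → nimF f (move x xs) ≡ nimF g (move x xs)
    same {x} x∈ = let shrinks = move-shrinks (proj₁ (∈-filterᵇ⁻ (not ∘ isBot) xs x∈)) in
      nimF-fuel f g (move x xs) (ℕP.≤-pred (ℕP.<-≤-trans shrinks ≤f)) (ℕP.≤-pred (ℕP.<-≤-trans shrinks ≤g))

  Nim-unfold : ∀ xs → Nim xs ≡ mex (options xs)
  Nim-unfold []       = refl
  Nim-unfold xs@(_ ∷ _) = cong mex (ListP.map-cong-local (All.tabulate λ {x} x∈ →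
    nimF-fuel _ _ (move x xs) (ℕP.≤-pred (move-shrinks (proj₁ (∈-filterᵇ⁻ (not ∘ isBot) xs x∈)))) ℕP.≤-refl))

module ChompMirror {A : Set} (leq : A → A → Bool) (isBot : A → Bool)
  (leq-refl : ∀ x → leq x x ≡ true)
  (P : List A) (τ : A → A) (core : A → Bool)
  (τ-closed     : ∀ {x} → x ∈ P → τ x ∈ P)
  (τ-involutive : ∀ {x} → x ∈ P → τ (τ x) ≡ x)
  (τ-leq        : ∀ {x z} → x ∈ P → z ∈ P → leq (τ x) (τ z) ≡ leq x z)
  (core⇒fixed   : ∀ {x} → x ∈ P → core x ≡ true → τ x ≡ x)
  (bot⇒core     : ∀ {x} → x ∈ P → isBot x ≡ true → core x ≡ true)
  (core-downward : ∀ {x z} → x ∈ P → z ∈ P → leq x z ≡ true → core z ≡ true → core x ≡ true)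
  (noncore≰τ    : ∀ {x} → x ∈ P → core x ≡ false → leq x (τ x) ≡ false)
  where

  open Chomp leq isBot
  open ChompProperties leq isBot leq-refl

  Pos : (A → Bool) → List A
  Pos q = filterᵇ q P

  τ-Invariant : (A → Bool) → Set
  τ-Invariant q = ∀ {z} → z ∈ P → q (τ z) ≡ q z

  cut : A → (A → Bool) → A → Bool
  cut x q z = q z ∧ not (leq x z)

  coreOf : (A → Bool) → A → Bool
  coreOf q z = q z ∧ core z

  ∈coreOf⁻ : ∀ q {x} → x ∈ Pos (coreOf q) → x ∈ Pos q × core x ≡ true
  ∈coreOf⁻ q x∈ with ∈-filterᵇ⁻ (coreOf q) P x∈
  ... | x∈P , qx∧cx = ∈-filterᵇ⁺ q x∈P (proj₁ (∧≡true⁻ qx∧cx)) , proj₂ (∧≡true⁻ qx∧cx)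

  ∈coreOf⁺ : ∀ q {x} → x ∈ Pos q → core x ≡ true → x ∈ Pos (coreOf q)
  ∈coreOf⁺ q x∈ cx with ∈-filterᵇ⁻ q P x∈
  ... | x∈P , qx = ∈-filterᵇ⁺ (coreOf q) x∈P (cong₂ _∧_ qx cx)

  core-τ : ∀ {x} → x ∈ P → core (τ x) ≡ core x
  core-τ {x} x∈ with core x in cx
  ... | true = trans (cong core (core⇒fixed x∈ cx)) cx
  ... | false with core (τ x) in cτx
  ...   | false = refl
  ...   | true  = ⊥-elim (true≢false (begin
    true            ≡⟨ leq-refl x ⟨
    leq x x         ≡⟨ cong (leq x) x≡τx ⟩
    leq x (τ x)     ≡⟨ noncore≰τ x∈ cx ⟩
    false           ∎))
    where
    open ≡-Reasoning
    x≡τx : x ≡ τ x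
    x≡τx = trans (sym (τ-involutive x∈)) (core⇒fixed (τ-closed x∈) cτx)

  noncore≰core : ∀ {x z} → x ∈ P → z ∈ P → core x ≡ false → core z ≡ true → leq x z ≡ false
  noncore≰core {x} {z} x∈ z∈ cx cz with leq x z in x≤z
  ... | false = refl
  ... | true  = ⊥-elim (true≢false (trans (sym (core-downward x∈ z∈ x≤z cz)) cx))

  move-Pos : ∀ x q → move x (Pos q) ≡ Pos (cut x q)
  move-Pos x q = filterᵇ-filterᵇ (not ∘ leq x) q P

  cut-shrinks : ∀ {x q} → x ∈ Pos q → length (Pos (cut x q)) ℕ.< length (Pos q)
  cut-shrinks {x} {q} x∈ = subst (ℕ._< length (Pos q)) (cong length (move-Pos x q)) (move-shrinks x∈)

  cut-fixed-invariant : ∀ {x q} → x ∈ P → τ x ≡ x → τ-Invariant q → τ-Invariant (cut x q)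
  cut-fixed-invariant {x} {q} x∈ τx≡x q-inv {z} z∈ =
    cong₂ (λ a b → a ∧ not b) (q-inv z∈) (trans (cong (λ y → leq y (τ z)) (sym τx≡x)) (τ-leq x∈ z∈))

  cut-pair-invariant : ∀ {x q} → x ∈ P → τ-Invariant q → τ-Invariant (cut (τ x) (cut x q))
  cut-pair-invariant {x} {q} x∈ q-inv {z} z∈ = begin
    (q (τ z) ∧ not (leq x (τ z))) ∧ not (leq (τ x) (τ z))
      ≡⟨ cong₂ (λ a b → (a ∧ not b) ∧ not (leq (τ x) (τ z))) (q-inv z∈) leq-x-τz ⟩
    (q z ∧ not (leq (τ x) z)) ∧ not (leq (τ x) (τ z))
      ≡⟨ cong (λ b → (q z ∧ not (leq (τ x) z)) ∧ not b) (τ-leq x∈ z∈) ⟩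
    (q z ∧ not (leq (τ x) z)) ∧ not (leq x z)
      ≡⟨ ∧-swapʳ (q z) _ _ ⟩
    (q z ∧ not (leq x z)) ∧ not (leq (τ x) z) ∎
    where
    open ≡-Reasoning
    leq-x-τz : leq x (τ z) ≡ leq (τ x) z
    leq-x-τz = trans (cong (λ y → leq y (τ z)) (sym (τ-involutive x∈))) (τ-leq (τ-closed x∈) z∈)

  coreOf-cut-pair : ∀ {x} q → x ∈ P → core x ≡ false → Pos (coreOf (cut (τ x) (cut x q))) ≡ Pos (coreOf q)
  coreOf-cut-pair {x} q x∈ cx = filterᵇ-cong-local P same
    where
    same : ∀ {z} → z ∈ P → ((q z ∧ not (leq x z)) ∧ not (leq (τ x) z)) ∧ core z ≡ q z ∧ core z
    same {z} z∈ with core z in cz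
    ... | false = trans (BoolP.∧-zeroʳ _) (sym (BoolP.∧-zeroʳ (q z)))
    ... | true  rewrite noncore≰core x∈ z∈ cx cz
                      | noncore≰core (τ-closed x∈) z∈ (trans (core-τ x∈) cx) cz
                      = trans (BoolP.∧-identityʳ _) (BoolP.∧-identityʳ _)

  coreOf-cut : ∀ x q → Pos (coreOf (cut x q)) ≡ Pos (cut x (coreOf q))
  coreOf-cut x q = filterᵇ-cong-local P λ {z} _ → ∧-swapʳ (q z) (not (leq x z)) (core z)

  NimAgreesWithCore : (A → Bool) → Set
  NimAgreesWithCore q = Nim (Pos q) ≡ Nim (Pos (coreOf q))

  module Step (q : A → Bool) (q-inv : τ-Invariant q)
              (IH : ∀ q′ → τ-Invariant q′ → length (Pos q′) ℕ.< length (Pos q) → NimAgreesWithCore q′) where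

    core-move : ∀ {x} → x ∈ Pos q → core x ≡ true → Nim (move x (Pos q)) ≡ Nim (move x (Pos (coreOf q)))
    core-move {x} x∈ cx = begin
      Nim (move x (Pos q))              ≡⟨ cong Nim (move-Pos x q) ⟩
      Nim (Pos (cut x q))               ≡⟨ IH (cut x q) (cut-fixed-invariant x∈P (core⇒fixed x∈P cx) q-inv)
                                              (cut-shrinks x∈) ⟩
      Nim (Pos (coreOf (cut x q)))      ≡⟨ cong Nim (coreOf-cut x q) ⟩
      Nim (Pos (cut x (coreOf q)))      ≡⟨ cong Nim (move-Pos x (coreOf q)) ⟨
      Nim (move x (Pos (coreOf q)))     ∎
      where
      open ≡-Reasoning
      x∈P = proj₁ (∈-filterᵇ⁻ q P x∈)

    -- The reply τ x to a non-core move x leads back to a position with the same core.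
    noncore-move : ∀ {x} → x ∈ Pos q → core x ≡ false → Nim (Pos (cut x q)) ≢ Nim (Pos (coreOf q))
    noncore-move {x} x∈ cx eq = proj₁ (mex-spec (options (Pos (cut x q))))
      (subst (_∈ options (Pos (cut x q))) reply-value (option∈ τx∈ (cong not τx-nonbot)))
      where
      x∈P = proj₁ (∈-filterᵇ⁻ q P x∈)
      τx∈ : τ x ∈ Pos (cut x q)
      τx∈ = ∈-filterᵇ⁺ (cut x q) (τ-closed x∈P)
        (cong₂ (λ a b → a ∧ not b) (trans (q-inv x∈P) (proj₂ (∈-filterᵇ⁻ q P x∈))) (noncore≰τ x∈P cx))
      τx-nonbot : isBot (τ x) ≡ false
      τx-nonbot with isBot (τ x) in bot
      ... | false = refl
      ... | true  = ⊥-elim (true≢false (trans (sym (bot⇒core (τ-closed x∈P) bot)) (trans (core-τ x∈P) cx)))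
      reply-value : Nim (move (τ x) (Pos (cut x q))) ≡ mex (options (Pos (cut x q)))
      reply-value = begin
        Nim (move (τ x) (Pos (cut x q)))        ≡⟨ cong Nim (move-Pos (τ x) (cut x q)) ⟩
        Nim (Pos (cut (τ x) (cut x q)))         ≡⟨ IH _ (cut-pair-invariant x∈P q-inv)
                                                      (ℕP.<-trans (cut-shrinks τx∈) (cut-shrinks x∈)) ⟩
        Nim (Pos (coreOf (cut (τ x) (cut x q)))) ≡⟨ cong Nim (coreOf-cut-pair q x∈P cx) ⟩
        Nim (Pos (coreOf q))                    ≡⟨ eq ⟨
        Nim (Pos (cut x q))                     ≡⟨ Nim-unfold (Pos (cut x q)) ⟩
        mex (options (Pos (cut x q)))           ∎
        where open ≡-Reasoning

    Nim-coreOf : NimAgreesWithCore q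
    Nim-coreOf = begin
      Nim (Pos q)                       ≡⟨ Nim-unfold (Pos q) ⟩
      mex (options (Pos q))             ≡⟨ mex-≡ core-options⊆ mex∉options ⟩
      mex (options (Pos (coreOf q)))    ≡⟨ Nim-unfold (Pos (coreOf q)) ⟨
      Nim (Pos (coreOf q))              ∎
      where
      open ≡-Reasoning
      core-options⊆ : options (Pos (coreOf q)) ⊆ options (Pos q)
      core-options⊆ j∈ with ∈options⁻ (Pos (coreOf q)) j∈
      ... | x , x∈ , nonbot , refl with ∈coreOf⁻ q x∈
      ...   | x∈q , cx = subst (_∈ options (Pos q)) (core-move x∈q cx) (option∈ x∈q nonbot)
      mex∉options : mex (options (Pos (coreOf q))) ∉ options (Pos q)
      mex∉options m∈ with ∈options⁻ (Pos q) m∈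
      ... | x , x∈q , nonbot , eq with core x in cx
      ...   | true  = proj₁ (mex-spec (options (Pos (coreOf q))))
        (subst (_∈ options (Pos (coreOf q))) (trans (sym (core-move x∈q cx)) (sym eq))
          (option∈ (∈coreOf⁺ q x∈q cx) nonbot))
      ...   | false = noncore-move x∈q cx (begin
        Nim (Pos (cut x q))                ≡⟨ cong Nim (move-Pos x q) ⟨
        Nim (move x (Pos q))               ≡⟨ eq ⟨
        mex (options (Pos (coreOf q)))     ≡⟨ Nim-unfold (Pos (coreOf q)) ⟨
        Nim (Pos (coreOf q))               ∎)

  Nim-coreOf-invariant : ∀ q → τ-Invariant q → NimAgreesWithCore q
  Nim-coreOf-invariant q q-inv = bounded (suc (length (Pos q))) q q-inv ℕP.≤-refl
    where
    bounded : ∀ f q → τ-Invariant q → length (Pos q) ℕ.< f → NimAgreesWithCore q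
    bounded (suc f) q q-inv <f = Step.Nim-coreOf q q-inv
      λ q′ q′-inv shorter → bounded f q′ q′-inv (ℕP.<-≤-trans shorter (ℕP.≤-pred <f))

  Nim-core : Nim P ≡ Nim (filterᵇ core P)
  Nim-core = trans (cong Nim (sym (ListP.filter-all (λ _ → T? true) (All.universal _ P))))
    (Nim-coreOf-invariant (λ _ → true) (λ _ → refl))

∣∣-≤-injection : ∀ {n m} (d : Subset n) (e : Subset m) (g : ∀ {j} → j ∈ₛ d → Fin m) →
  (∀ {j} (j∈ : j ∈ₛ d) → g j∈ ∈ₛ e) →
  (∀ {j j′} (j∈ : j ∈ₛ d) (j′∈ : j′ ∈ₛ d) → g j∈ ≡ g j′∈ → j ≡ j′) →
  ∣ d ∣ ≤ ∣ e ∣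
∣∣-≤-injection []            e g g∈ g-inj = z≤n
∣∣-≤-injection (outside ∷ d) e g g∈ g-inj =
  ∣∣-≤-injection d e (g ∘ Vec.there) (g∈ ∘ Vec.there)
    (λ j∈ j′∈ eq → FinP.suc-injective (g-inj (Vec.there j∈) (Vec.there j′∈) eq))
∣∣-≤-injection (inside ∷ d)  e g g∈ g-inj = ℕP.≤-trans
  (s≤s (∣∣-≤-injection d (e -ₛ g Vec.here) (g ∘ Vec.there)
    (λ j∈ → x∈p∧x≢y⇒x∈p-y (g∈ (Vec.there j∈)) (FinP.0≢1+n ∘ g-inj Vec.here (Vec.there j∈) ∘ sym))
    (λ j∈ j′∈ eq → FinP.suc-injective (g-inj (Vec.there j∈) (Vec.there j′∈) eq))))
  (x∈p⇒∣p-x∣<∣p∣ (g∈ Vec.here))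

∣p∣≡∣p∩q∣+∣p─q∣ : ∀ {n} (p q : Subset n) → ∣ p ∣ ≡ ∣ p ∩ q ∣ + ∣ p ─ q ∣
∣p∣≡∣p∩q∣+∣p─q∣ []            []            = refl
∣p∣≡∣p∩q∣+∣p─q∣ (outside ∷ p) (inside ∷ q)  = ∣p∣≡∣p∩q∣+∣p─q∣ p q
∣p∣≡∣p∩q∣+∣p─q∣ (outside ∷ p) (outside ∷ q) = ∣p∣≡∣p∩q∣+∣p─q∣ p q
∣p∣≡∣p∩q∣+∣p─q∣ (inside ∷ p)  (inside ∷ q)  = cong suc (∣p∣≡∣p∩q∣+∣p─q∣ p q)
∣p∣≡∣p∩q∣+∣p─q∣ (inside ∷ p)  (outside ∷ q) = trans (cong suc (∣p∣≡∣p∩q∣+∣p─q∣ p q)) (sym (ℕP.+-suc _ _))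

∈─⁻ : ∀ {n} {p q : Subset n} {j} → j ∈ₛ p ─ q → lookup p j ≡ true × lookup q j ≡ false
∈─⁻ {p = inside ∷ p} {outside ∷ q} Vec.here        = refl , refl
∈─⁻ {p = _ ∷ p}      {inside ∷ q}  (Vec.there j∈) = ∈─⁻ j∈
∈─⁻ {p = _ ∷ p}      {outside ∷ q} (Vec.there j∈) = ∈─⁻ j∈

vec-ext : ∀ {A : Set} {n} {u v : Vec A n} → (∀ j → lookup u j ≡ lookup v j) → u ≡ v
vec-ext {u = u} {v} eq = trans (sym (tabulate∘lookup u)) (trans (tabulate-cong eq) (tabulate∘lookup v))

≟ˢ-refl : ∀ {n} (u : Subset n) → u ≟ˢ u ≡ true
≟ˢ-refl u with ≡-dec BoolP._≟_ u u
... | yes _   = refl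
... | no u≢u = ⊥-elim (u≢u refl)

≟ˢ⇒≡ : ∀ {n} {u v : Subset n} → u ≟ˢ v ≡ true → u ≡ v
≟ˢ⇒≡ {u = u} {v} _ with ≡-dec BoolP._≟_ u v
... | yes u≡v = u≡v

≟ˢ-cong : ∀ {n} {u v u′ v′ : Subset n} → (u ≡ v ⇔ u′ ≡ v′) → (u ≟ˢ v) ≡ (u′ ≟ˢ v′)
≟ˢ-cong {u = u} {v} {u′} {v′} iff with ≡-dec BoolP._≟_ u v | ≡-dec BoolP._≟_ u′ v′
... | yes _   | yes _     = refl
... | no _    | no _      = refl
... | yes u≡v | no u′≢v′ = ⊥-elim (u′≢v′ (Equivalence.to iff u≡v))
... | no u≢v  | yes u′≡v′ = ⊥-elim (u≢v (Equivalence.from iff u′≡v′))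

adjKG-sym : ∀ {n} l (u v : Subset n) → adjKG l u v ≡ adjKG l v u
adjKG-sym l u v = cong₂ (λ a m → not a ∧ (+ m ≤ᵇ l)) (≟ˢ-cong (mk⇔ sym sym)) (cong ∣_∣ (∩-comm u v))

k≤m+t⇒m≰ᵇl : ∀ {k m t : ℕ} {l : ℤ} → k ≤ m + t → + t < + k - l → (+ m ≤ᵇ l) ≡ false
k≤m+t⇒m≰ᵇl {k} {m} {t} {l} k≤m+t t<k-l with + m ≤ᵇ l in m≤ᵇl
... | false = refl
... | true  = ⊥-elim (ℤP.<-irrefl refl (ℤP.<-≤-trans t<k-l (begin
  + k - l      ≤⟨ ℤP.+-monoʳ-≤ (+ k) (ℤP.neg-mono-≤ (ℤP.≤ᵇ⇒≤ {+ m} {l} (Equivalence.from BoolP.T-≡ m≤ᵇl))) ⟩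
  + k - + m    ≡⟨ ℤP.m-n≡m⊖n k m ⟩
  k ⊖ m        ≤⟨ ℤP.⊖-monoˡ-≤ m k≤m+t ⟩
  (m + t) ⊖ m  ≡⟨ ℤP.≤-⊖ (ℕP.m≤m+n m t) ⟩
  + (m + t ∸ m) ≡⟨ cong +_ (ℕP.m+n∸m≡n m t) ⟩
  + t          ∎)))
  where open ℤP.≤-Reasoning

module ImageOfInvolution {n} (f : Fin n → Fin n) (f-involutive : ∀ j → f (f j) ≡ j) where

  lookup-image : ∀ u j → lookup (image f u) j ≡ lookup u (f j)
  lookup-image u j = trans (lookup∘tabulate _ j) (≡-from-true⇔true hit⇒ ⇒hit)
    where
    hit : Fin n → Bool
    hit x = lookup u x ∧ ⌊ f x ≟ j ⌋
    hit⇒ : any hit (List.allFin n) ≡ true → lookup u (f j) ≡ true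
    hit⇒ any-hit with Any.satisfied (AnyP.any⁻ hit (List.allFin n) (Equivalence.from BoolP.T-≡ any-hit))
    ... | x , hit-x with Equivalence.to BoolP.T-∧ hit-x
    ...   | ux , fx≡j = subst (λ y → lookup u y ≡ true) (trans (sym (f-involutive x)) (cong f (toWitness fx≡j)))
                          (Equivalence.to BoolP.T-≡ ux)
    ⇒hit : lookup u (f j) ≡ true → any hit (List.allFin n) ≡ true
    ⇒hit uf = Equivalence.to BoolP.T-≡ (AnyP.any⁺ hit (Any.map hit-fj (∈-allFin (f j))))
      where
      hit-fj : ∀ {x} → f j ≡ x → T (hit x)
      hit-fj refl = Equivalence.from BoolP.T-∧ (Equivalence.from BoolP.T-≡ uf , fromWitness (f-involutive j))

  image-involutive : ∀ u → image f (image f u) ≡ u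
  image-involutive u = vec-ext λ j → begin
    lookup (image f (image f u)) j   ≡⟨ lookup-image (image f u) j ⟩
    lookup (image f u) (f j)         ≡⟨ lookup-image u (f j) ⟩
    lookup u (f (f j))               ≡⟨ cong (lookup u) (f-involutive j) ⟩
    lookup u j                       ∎
    where open ≡-Reasoning

  image-injective : ∀ {u v} → image f u ≡ image f v → u ≡ v
  image-injective {u} {v} eq = trans (sym (image-involutive u)) (trans (cong (image f) eq) (image-involutive v))

  image-∩ : ∀ u v → image f (u ∩ v) ≡ image f u ∩ image f v
  image-∩ u v = vec-ext λ j → begin
    lookup (image f (u ∩ v)) j              ≡⟨ lookup-image (u ∩ v) j ⟩
    lookup (u ∩ v) (f j)                    ≡⟨ lookup-zipWith _∧_ (f j) u v ⟩
    lookup u (f j) ∧ lookup v (f j)         ≡⟨ cong₂ _∧_ (lookup-image u j) (lookup-image v j) ⟨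
    lookup (image f u) j ∧ lookup (image f v) j ≡⟨ lookup-zipWith _∧_ j (image f u) (image f v) ⟨
    lookup (image f u ∩ image f v) j        ∎
    where open ≡-Reasoning

  ∣image∣≤ : ∀ u → ∣ image f u ∣ ≤ ∣ u ∣
  ∣image∣≤ u = ∣∣-≤-injection (image f u) u (λ {j} _ → f j)
    (λ {j} j∈ → lookup⇒[]= (f j) u (trans (sym (lookup-image u j)) ([]=⇒lookup j∈)))
    (λ {j} {j′} _ _ eq → trans (sym (f-involutive j)) (trans (cong f eq) (f-involutive j′)))

  ∣image∣ : ∀ u → ∣ image f u ∣ ≡ ∣ u ∣
  ∣image∣ u = ℕP.≤-antisym (∣image∣≤ u)
    (subst (λ w → ∣ w ∣ ≤ ∣ image f u ∣) (image-involutive u) (∣image∣≤ (image f u)))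

  adjKG-image : ∀ l u v → adjKG l (image f u) (image f v) ≡ adjKG l u v
  adjKG-image l u v = cong₂ (λ a m → not a ∧ (+ m ≤ᵇ l))
    (≟ˢ-cong (mk⇔ image-injective (cong (image f))))
    (trans (cong ∣_∣ (sym (image-∩ u v))) (∣image∣ (u ∩ v)))

transp-left : ∀ {n} (x y : Fin n) → transp x y x ≡ y
transp-left x y with x ≟ x
... | yes _   = refl
... | no x≢x = ⊥-elim (x≢x refl)

transp-right : ∀ {n} {x y : Fin n} → x ≢ y → transp x y y ≡ x
transp-right {x = x} {y} x≢y with y ≟ x | y ≟ y
... | yes y≡x | _       = ⊥-elim (x≢y (sym y≡x))
... | no _    | yes _   = refl
... | no _    | no y≢y = ⊥-elim (y≢y refl)

transp-other : ∀ {n} {x y z : Fin n} → z ≢ x → z ≢ y → transp x y z ≡ z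
transp-other {x = x} {y} {z} z≢x z≢y with z ≟ x | z ≟ y
... | yes z≡x | _       = ⊥-elim (z≢x z≡x)
... | no _    | yes z≡y = ⊥-elim (z≢y z≡y)
... | no _    | no _    = refl

module Transpositions {n t} (b c : Fin t → Fin n)
  (b-injective : Injective _≡_ _≡_ b) (c-injective : Injective _≡_ _≡_ c) (b≢c : ∀ i j → b i ≢ c j) where

  swaps : List (Fin t) → Fin n → Fin n
  swaps is z = List.foldr (λ i w → transp (b i) (c i) w) z is

  swaps-untouched : ∀ is {z} → (∀ {i} → i ∈ is → z ≢ b i × z ≢ c i) → swaps is z ≡ z
  swaps-untouched []       away = refl
  swaps-untouched (i ∷ is) away = trans (cong (transp (b i) (c i)) (swaps-untouched is (away ∘ there)))
    (transp-other (proj₁ (away (here refl))) (proj₂ (away (here refl))))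

  swaps-b : ∀ {is} → Unique is → ∀ {i} → i ∈ is → swaps is (b i) ≡ c i
  swaps-b {i ∷ is} (i∉ ∷ _) (here refl) = trans
    (cong (transp (b i) (c i)) (swaps-untouched is λ i′∈ → (All.lookup i∉ i′∈ ∘ b-injective) , b≢c i _))
    (transp-left (b i) (c i))
  swaps-b {i′ ∷ is} (i′∉ ∷ u) {i} (there i∈) = trans (cong (transp (b i′) (c i′)) (swaps-b u i∈))
    (transp-other (b≢c i′ i ∘ sym) (All.lookup i′∉ i∈ ∘ sym ∘ c-injective))

  swaps-c : ∀ {is} → Unique is → ∀ {i} → i ∈ is → swaps is (c i) ≡ b i
  swaps-c {i ∷ is} (i∉ ∷ _) (here refl) = trans
    (cong (transp (b i) (c i)) (swaps-untouched is λ i′∈ → (b≢c _ i ∘ sym) , (All.lookup i∉ i′∈ ∘ c-injective)))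
    (transp-right (b≢c i i))
  swaps-c {i′ ∷ is} (i′∉ ∷ u) {i} (there i∈) = trans (cong (transp (b i′) (c i′)) (swaps-c u i∈))
    (transp-other (All.lookup i′∉ i∈ ∘ sym ∘ b-injective) (b≢c i i′))

  π : Fin n → Fin n
  π = perm b c

  π-b : ∀ i → π (b i) ≡ c i
  π-b i = swaps-b (allFin⁺ t) (∈-allFin i)

  π-c : ∀ i → π (c i) ≡ b i
  π-c i = swaps-c (allFin⁺ t) (∈-allFin i)

  Moved : Fin n → Set
  Moved z = ∃ λ i → b i ≡ z ⊎ c i ≡ z

  moved? : ∀ z → Dec (Moved z)
  moved? z = FinP.any? (λ i → (b i ≟ z) ⊎-dec (c i ≟ z))

  π-unmoved : ∀ {z} → ¬ Moved z → π z ≡ z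
  π-unmoved ¬moved = swaps-untouched (List.allFin t) λ {i} _ →
    (¬moved ∘ (i ,_) ∘ inj₁ ∘ sym) , (¬moved ∘ (i ,_) ∘ inj₂ ∘ sym)

  π-involutive : ∀ z → π (π z) ≡ z
  π-involutive z with moved? z
  ... | yes (i , inj₁ refl) = trans (cong π (π-b i)) (π-c i)
  ... | yes (i , inj₂ refl) = trans (cong π (π-c i)) (π-b i)
  ... | no ¬moved           = trans (cong π (π-unmoved ¬moved)) (π-unmoved ¬moved)

  open ImageOfInvolution π π-involutive public

  pairedᵇ⇔agree : ∀ u → pairedᵇ b c u ≡ true ⇔ (∀ i → lookup u (b i) ≡ lookup u (c i))
  pairedᵇ⇔agree u = mk⇔
    (λ paired i → agree-on
      (All.lookup (AllP.all⁺ _ (List.allFin t) (Equivalence.from BoolP.T-≡ paired)) (∈-allFin i)))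
    (λ agree → Equivalence.to BoolP.T-≡ (AllP.all⁻ _ {xs = List.allFin t} (All.tabulate λ {i} _ →
      subst (T ∘ not ∘ (lookup u (b i) xor_)) (agree i) (agree-self (lookup u (b i))))))
    where
    agree-on : ∀ {x y} → T (not (x xor y)) → x ≡ y
    agree-on {true}  {true}  _ = refl
    agree-on {false} {false} _ = refl
    agree-self : ∀ x → T (not (x xor x))
    agree-self true  = _
    agree-self false = _

  fixed⇔agree : ∀ u → image π u ≡ u ⇔ (∀ i → lookup u (b i) ≡ lookup u (c i))
  fixed⇔agree u = mk⇔
    (λ fixed i → begin
      lookup u (b i)              ≡⟨ cong (λ w → lookup w (b i)) fixed ⟨
      lookup (image π u) (b i)    ≡⟨ lookup-image u (b i) ⟩
      lookup u (π (b i))          ≡⟨ cong (lookup u) (π-b i) ⟩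
      lookup u (c i)              ∎)
    (λ agree → vec-ext λ j → trans (lookup-image u j) (π-respects agree j))
    where
    open ≡-Reasoning
    π-respects : (∀ i → lookup u (b i) ≡ lookup u (c i)) → ∀ j → lookup u (π j) ≡ lookup u j
    π-respects agree j with moved? j
    ... | yes (i , inj₁ refl) = trans (cong (lookup u) (π-b i)) (sym (agree i))
    ... | yes (i , inj₂ refl) = trans (cong (lookup u) (π-c i)) (agree i)
    ... | no ¬moved           = cong (lookup u) (π-unmoved ¬moved)

  ∣─image∣≤t : ∀ u → ∣ u ─ image π u ∣ ≤ t
  ∣─image∣≤t u = subst (∣ u ─ image π u ∣ ≤_) (∣⊤∣≡n t)
    (∣∣-≤-injection (u ─ image π u) ⊤ (proj₁ ∘ moved) (λ _ → ∈⊤)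
      (λ j∈ j′∈ → same-pair j∈ j′∈ (moved j∈) (moved j′∈)))
    where
    escapes : ∀ {j} → j ∈ₛ u ─ image π u → lookup u j ≡ true × lookup u (π j) ≡ false
    escapes j∈ = proj₁ (∈─⁻ j∈) , trans (sym (lookup-image u _)) (proj₂ (∈─⁻ j∈))
    moved : ∀ {j} → j ∈ₛ u ─ image π u → Moved j
    moved {j} j∈ with moved? j
    ... | yes m      = m
    ... | no ¬moved = ⊥-elim (true≢false (begin
      true             ≡⟨ proj₁ (escapes j∈) ⟨
      lookup u j       ≡⟨ cong (lookup u) (π-unmoved ¬moved) ⟨
      lookup u (π j)   ≡⟨ proj₂ (escapes j∈) ⟩
      false            ∎))
      where open ≡-Reasoning
    -- b i and c i cannot both lie in u while their images lie outside it.
    same-pair : ∀ {j j′} → j ∈ₛ u ─ image π u → j′ ∈ₛ u ─ image π u →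
                (m : Moved j) (m′ : Moved j′) → proj₁ m ≡ proj₁ m′ → j ≡ j′
    same-pair _  _   (i , inj₁ refl) (_ , inj₁ refl) refl = refl
    same-pair _  _   (i , inj₂ refl) (_ , inj₂ refl) refl = refl
    same-pair j∈ j′∈ (i , inj₁ refl) (_ , inj₂ refl) refl =
      ⊥-elim (true≢false (trans (sym (proj₁ (escapes j′∈)))
        (trans (cong (lookup u) (sym (π-b i))) (proj₂ (escapes j∈)))))
    same-pair j∈ j′∈ (i , inj₂ refl) (_ , inj₁ refl) refl =
      ⊥-elim (true≢false (trans (sym (proj₁ (escapes j′∈)))
        (trans (cong (lookup u) (sym (π-c i))) (proj₂ (escapes j∈)))))

  ∣∣≤∣∩image∣+t : ∀ u → ∣ u ∣ ≤ ∣ u ∩ image π u ∣ + t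
  ∣∣≤∣∩image∣+t u = subst (_≤ ∣ u ∩ image π u ∣ + t) (sym (∣p∣≡∣p∩q∣+∣p─q∣ u (image π u)))
    (ℕP.+-monoʳ-≤ ∣ u ∩ image π u ∣ (∣─image∣≤t u))

  pairedᵇ≡fixed : ∀ u → pairedᵇ b c u ≡ (u ≟ˢ image π u)
  pairedᵇ≡fixed u = ≡-from-true⇔true
    (λ paired → subst (λ w → u ≟ˢ w ≡ true)
      (sym (Equivalence.from (fixed⇔agree u) (Equivalence.to (pairedᵇ⇔agree u) paired))) (≟ˢ-refl u))
    (λ fixed → Equivalence.from (pairedᵇ⇔agree u) (Equivalence.to (fixed⇔agree u) (sym (≟ˢ⇒≡ fixed))))

  image-nonadjacent : ∀ {k} l {u} → ∣ u ∣ ≡ k → + t < + k - l → adjKG l u (image π u) ≡ false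
  image-nonadjacent l {u} refl t<k-l =
    trans (cong (not (u ≟ˢ image π u) ∧_) (k≤m+t⇒m≰ᵇl {l = l} (∣∣≤∣∩image∣+t u) t<k-l)) (BoolP.∧-zeroʳ _)

module _ {B : Set} where

  pairs-∈ : ∀ {u v : B} xs → (u , v) ∈ pairs xs → u ∈ xs × v ∈ xs
  pairs-∈ (x ∷ xs) uv∈ with ∈-++⁻ (map (x ,_) xs) uv∈
  ... | inj₁ uv∈x,xs with ∈-map⁻ (x ,_) uv∈x,xs
  ...   | _ , v∈ , refl = here refl , there v∈
  pairs-∈ (x ∷ xs) _ | inj₂ uv∈pairs = Data.Product.map there there (pairs-∈ xs uv∈pairs)

  pairs-either : ∀ {u v : B} xs → u ∈ xs → v ∈ xs → u ≢ v → (u , v) ∈ pairs xs ⊎ (v , u) ∈ pairs xs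
  pairs-either (x ∷ xs) (here refl) (here refl) u≢v = ⊥-elim (u≢v refl)
  pairs-either (x ∷ xs) (here refl) (there v∈)  _   = inj₁ (∈-++⁺ˡ (∈-map⁺ (x ,_) v∈))
  pairs-either (x ∷ xs) (there u∈)  (here refl) _   = inj₂ (∈-++⁺ˡ (∈-map⁺ (x ,_) u∈))
  pairs-either (x ∷ xs) (there u∈)  (there v∈)  u≢v =
    Data.Sum.map (∈-++⁺ʳ (map (x ,_) xs)) (∈-++⁺ʳ (map (x ,_) xs)) (pairs-either xs u∈ v∈ u≢v)

  pairs-asym : ∀ {u v : B} {xs} → Unique xs → (u , v) ∈ pairs xs → (v , u) ∉ pairs xs
  pairs-asym {xs = x ∷ xs} (x∉ ∷ unique) uv∈ vu∈ with ∈-++⁻ (map (x ,_) xs) uv∈ | ∈-++⁻ (map (x ,_) xs) vu∈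
  ... | inj₁ uv∈x,xs | inj₁ vu∈x,xs with ∈-map⁻ (x ,_) uv∈x,xs | ∈-map⁻ (x ,_) vu∈x,xs
  ...   | _ , x∈ , refl | _ , _ , refl = All.lookup x∉ x∈ refl
  pairs-asym {xs = x ∷ xs} (x∉ ∷ unique) _ _ | inj₁ uv∈x,xs | inj₂ vu∈pairs with ∈-map⁻ (x ,_) uv∈x,xs
  ...   | _ , _ , refl = All.lookup x∉ (proj₂ (pairs-∈ xs vu∈pairs)) refl
  pairs-asym {xs = x ∷ xs} (x∉ ∷ unique) _ _ | inj₂ uv∈pairs | inj₁ vu∈x,xs with ∈-map⁻ (x ,_) vu∈x,xs
  ...   | _ , _ , refl = All.lookup x∉ (proj₂ (pairs-∈ xs uv∈pairs)) refl
  pairs-asym {xs = x ∷ xs} (x∉ ∷ unique) _ _ | inj₂ uv∈pairs | inj₂ vu∈pairs = pairs-asym unique uv∈pairs vu∈pairs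

  pairs-distinct : ∀ {u v : B} {xs} → Unique xs → (u , v) ∈ pairs xs → u ≢ v
  pairs-distinct unique uv∈ refl = pairs-asym unique uv∈ uv∈

  pairs-filterᵇ : ∀ (p : B → Bool) xs →
    pairs (filterᵇ p xs) ≡ filterᵇ (λ pr → p (proj₁ pr) ∧ p (proj₂ pr)) (pairs xs)
  pairs-filterᵇ p []       = refl
  pairs-filterᵇ p (x ∷ xs) with p x in px
  ... | true = begin
    map (x ,_) (filterᵇ p xs) ++ pairs (filterᵇ p xs)
      ≡⟨ cong₂ _++_ (cong (map (x ,_)) (filterᵇ-cong-local xs λ {z} _ → cong (_∧ p z) (sym px)))
                    (pairs-filterᵇ p xs) ⟩
    map (x ,_) (filterᵇ (both ∘ (x ,_)) xs) ++ filterᵇ both (pairs xs)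
      ≡⟨ cong (_++ filterᵇ both (pairs xs)) (filterᵇ-map both (x ,_) xs) ⟨
    filterᵇ both (map (x ,_) xs) ++ filterᵇ both (pairs xs)
      ≡⟨ ListP.filter-++ (T? ∘ both) (map (x ,_) xs) (pairs xs) ⟨
    filterᵇ both (pairs (x ∷ xs)) ∎
    where
    open ≡-Reasoning
    both : B × B → Bool
    both pr = p (proj₁ pr) ∧ p (proj₂ pr)
  ... | false = begin
    pairs (filterᵇ p xs)
      ≡⟨ pairs-filterᵇ p xs ⟩
    filterᵇ both (pairs xs)
      ≡⟨ cong (_++ filterᵇ both (pairs xs)) none ⟨
    filterᵇ both (map (x ,_) xs) ++ filterᵇ both (pairs xs)
      ≡⟨ ListP.filter-++ (T? ∘ both) (map (x ,_) xs) (pairs xs) ⟨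
    filterᵇ both (pairs (x ∷ xs)) ∎
    where
    open ≡-Reasoning
    both : B × B → Bool
    both pr = p (proj₁ pr) ∧ p (proj₂ pr)
    none : filterᵇ both (map (x ,_) xs) ≡ []
    none = trans (filterᵇ-map both (x ,_) xs) (cong (map (x ,_)) (trans
      (filterᵇ-cong-local xs λ {z} _ → cong (_∧ p z) px)
      (ListP.filter-none (T? ∘ λ _ → false) (All.universal (λ _ ()) xs))))

∈-allSubsets : ∀ {n} (u : Subset n) → u ∈ allSubsets n
∈-allSubsets []                = here refl
∈-allSubsets {suc n} (true ∷ u)  = ∈-++⁺ˡ (∈-map⁺ (true ∷_) (∈-allSubsets u))
∈-allSubsets {suc n} (false ∷ u) = ∈-++⁺ʳ (map (true ∷_) (allSubsets n)) (∈-map⁺ (false ∷_) (∈-allSubsets u))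

allSubsets-unique : ∀ n → Unique (allSubsets n)
allSubsets-unique zero    = All.[] ∷ []
allSubsets-unique (suc n) = UniqueP.++⁺ (UniqueP.map⁺ ∷-injectiveʳ (allSubsets-unique n))
                                        (UniqueP.map⁺ ∷-injectiveʳ (allSubsets-unique n)) disjoint
  where
  ∷-injectiveʳ : ∀ {x} {u v : Subset n} → x ∷ u ≡ x ∷ v → u ≡ v
  ∷-injectiveʳ refl = refl
  disjoint : ∀ {u} → ¬ (u ∈ map (true ∷_) (allSubsets n) × u ∈ map (false ∷_) (allSubsets n))
  disjoint (∈true , ∈false) with ∈-map⁻ (true ∷_) ∈true | ∈-map⁻ (false ∷_) ∈false
  ... | _ , _ , refl | _ , _ , ()

vertsKG-∧ : ∀ n k (inV p : Subset n → Bool) → vertsKG n k (λ u → inV u ∧ p u) ≡ filterᵇ p (vertsKG n k inV)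
vertsKG-∧ n k inV p = sym (trans (filterᵇ-filterᵇ p _ (allSubsets n))
  (filterᵇ-cong-local (allSubsets n) λ {u} _ → BoolP.∧-assoc ⌊ ∣ u ∣ ℕ.≟ k ⌋ (inV u) (p u)))

∈-vertsKG⁺ : ∀ {n k inV} {u : Subset n} → InV k inV u → u ∈ vertsKG n k inV
∈-vertsKG⁺ {k = k} {inV} {u} (∣u∣≡k , inV-u) = ∈-filterᵇ⁺ _ (∈-allSubsets u) selected
  where
  selected : ⌊ ∣ u ∣ ℕ.≟ k ⌋ ∧ inV u ≡ true
  selected with ∣ u ∣ ℕ.≟ k
  ... | yes _      = inV-u
  ... | no ∣u∣≢k = ⊥-elim (∣u∣≢k ∣u∣≡k)

∈-vertsKG⁻ : ∀ {n k inV} {u : Subset n} → u ∈ vertsKG n k inV → InV k inV u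
∈-vertsKG⁻ {n} {k} {inV} {u} u∈ with ∈-filterᵇ⁻ _ (allSubsets n) u∈
... | _ , sel with ∣ u ∣ ℕ.≟ k
...   | yes ∣u∣≡k = ∣u∣≡k , sel

leqG-refl : ∀ {n} (x : GElem n) → leqG x x ≡ true
leqG-refl bot       = refl
leqG-refl (vtx u)   = ≟ˢ-refl u
leqG-refl (edg u v) = cong₂ _∧_ (≟ˢ-refl u) (≟ˢ-refl v)

leqG-edg⇒≡ : ∀ {n} {u v : Subset n} z → leqG (edg u v) z ≡ true → edg u v ≡ z
leqG-edg⇒≡ (edg u′ v′) uv≤z = let u≟u′ , v≟v′ = ∧≡true⁻ uv≤z in cong₂ edg (≟ˢ⇒≡ u≟u′) (≟ˢ⇒≡ v≟v′)

module GraphMirror {n} (vs : List (Subset n)) (adj : Subset n → Subset n → Bool) (σ : Subset n → Subset n)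
  (vs-unique     : Unique vs)
  (σ-closed      : ∀ {u} → u ∈ vs → σ u ∈ vs)
  (σ-involutive  : ∀ u → σ (σ u) ≡ u)
  (adj-sym       : ∀ u v → adj u v ≡ adj v u)
  (adj-σ         : ∀ u v → adj (σ u) (σ v) ≡ adj u v)
  (σ-nonadjacent : ∀ {u} → u ∈ vs → adj u (σ u) ≡ false)
  where

  σ-injective : ∀ {u v} → σ u ≡ σ v → u ≡ v
  σ-injective {u} {v} eq = trans (sym (σ-involutive u)) (trans (cong σ eq) (σ-involutive v))

  ≟ˢ-σ : ∀ u v → (σ u ≟ˢ σ v) ≡ (u ≟ˢ v)
  ≟ˢ-σ u v = ≟ˢ-cong (mk⇔ σ-injective (cong σ))

  fixed : Subset n → Bool
  fixed u = u ≟ˢ σ u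

  Edge : Set
  Edge = Subset n × Subset n

  E : Edge → GElem n
  E (u , v) = edg u v

  isEdge : Edge → Bool
  isEdge (u , v) = adj u v

  P : List (GElem n)
  P = graphPoset vs adj

  _≟ᴱ_ : (e e′ : Edge) → Dec (e ≡ e′)
  _≟ᴱ_ = Data.Product.Properties.≡-dec (≡-dec BoolP._≟_) (≡-dec BoolP._≟_)

  open Data.List.Membership.DecPropositional _≟ᴱ_ using (_∈?_)

  -- graphPoset contains each edge only in the orientation in which it occurs in pairs vs.
  orient : Edge → Edge
  orient e with e ∈? pairs vs
  ... | yes _ = e
  ... | no _  = Data.Product.swap e

  orient-id : ∀ {e} → e ∈ pairs vs → orient e ≡ e
  orient-id {e} e∈ with e ∈? pairs vs
  ... | yes _  = refl
  ... | no e∉ = ⊥-elim (e∉ e∈)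

  orient-swap : ∀ {u v} → (v , u) ∈ pairs vs → orient (u , v) ≡ (v , u)
  orient-swap {u} {v} vu∈ with (u , v) ∈? pairs vs
  ... | yes uv∈ = ⊥-elim (pairs-asym vs-unique vu∈ uv∈)
  ... | no _    = refl

  τ : GElem n → GElem n
  τ bot       = bot
  τ (vtx u)   = vtx (σ u)
  τ (edg u v) = E (orient (σ u , σ v))

  core : GElem n → Bool
  core bot       = true
  core (vtx u)   = fixed u
  core (edg u v) = fixed u ∧ fixed v

  data InP : GElem n → Set where
    bot∈ : InP bot
    vtx∈ : ∀ {u} → u ∈ vs → InP (vtx u)
    edg∈ : ∀ {u v} → (u , v) ∈ pairs vs → adj u v ≡ true → InP (edg u v)

  InP⇒∈ : ∀ {x} → InP x → x ∈ P
  InP⇒∈ bot∈          = here refl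
  InP⇒∈ (vtx∈ u∈)     = there (∈-++⁺ˡ (∈-map⁺ vtx u∈))
  InP⇒∈ (edg∈ uv∈ uv) = there (∈-++⁺ʳ (map vtx vs) (∈-map⁺ E (∈-filterᵇ⁺ isEdge uv∈ uv)))

  ∈⇒InP : ∀ {x} → x ∈ P → InP x
  ∈⇒InP (here refl) = bot∈
  ∈⇒InP (there x∈) with ∈-++⁻ (map vtx vs) x∈
  ... | inj₁ x∈vtx with ∈-map⁻ vtx x∈vtx
  ...   | _ , u∈ , refl = vtx∈ u∈
  ∈⇒InP (there x∈) | inj₂ x∈edg with ∈-map⁻ E x∈edg
  ...   | _ , uv∈ , refl = edg∈ (proj₁ (∈-filterᵇ⁻ isEdge (pairs vs) uv∈)) (proj₂ (∈-filterᵇ⁻ isEdge (pairs vs) uv∈))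

  σ-edge : ∀ {u v} → (u , v) ∈ pairs vs →
    (orient (σ u , σ v) ≡ (σ u , σ v) × (σ u , σ v) ∈ pairs vs) ⊎
    (orient (σ u , σ v) ≡ (σ v , σ u) × (σ v , σ u) ∈ pairs vs)
  σ-edge uv∈ with pairs-∈ vs uv∈
  ... | u∈ , v∈ with pairs-either vs (σ-closed u∈) (σ-closed v∈) (pairs-distinct vs-unique uv∈ ∘ σ-injective)
  ...   | inj₁ σuv∈ = inj₁ (orient-id σuv∈ , σuv∈)
  ...   | inj₂ σvu∈ = inj₂ (orient-swap σvu∈ , σvu∈)

  τ-closed : ∀ {x} → x ∈ P → τ x ∈ P
  τ-closed = InP⇒∈ ∘ τ-InP ∘ ∈⇒InP
    where
    τ-InP : ∀ {x} → InP x → InP (τ x)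
    τ-InP bot∈                    = bot∈
    τ-InP (vtx∈ u∈)               = vtx∈ (σ-closed u∈)
    τ-InP (edg∈ {u} {v} uv∈ uv) with σ-edge uv∈
    ... | inj₁ (eq , σuv∈) rewrite eq = edg∈ σuv∈ (trans (adj-σ u v) uv)
    ... | inj₂ (eq , σvu∈) rewrite eq = edg∈ σvu∈ (trans (adj-sym (σ v) (σ u)) (trans (adj-σ u v) uv))

  τ-involutive : ∀ {x} → x ∈ P → τ (τ x) ≡ x
  τ-involutive x∈ with ∈⇒InP x∈
  ... | bot∈      = refl
  ... | vtx∈ {u} _ = cong vtx (σ-involutive u)
  ... | edg∈ {u} {v} uv∈ _ with σ-edge uv∈
  ...   | inj₁ (eq , _) rewrite eq | σ-involutive u | σ-involutive v = cong E (orient-id uv∈)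
  ...   | inj₂ (eq , _) rewrite eq | σ-involutive u | σ-involutive v = cong E (orient-swap uv∈)

  τ-leq : ∀ {x z} → x ∈ P → z ∈ P → leqG (τ x) (τ z) ≡ leqG x z
  τ-leq {x} {z} x∈ z∈ with ∈⇒InP x∈ | ∈⇒InP z∈
  ... | bot∈          | _             = refl
  ... | vtx∈ _        | bot∈          = refl
  ... | vtx∈ {w} _    | vtx∈ {u} _    = ≟ˢ-σ w u
  ... | vtx∈ {w} _    | edg∈ {u} {v} uv∈ _ with σ-edge uv∈
  ...   | inj₁ (eq , _) rewrite eq = cong₂ _∨_ (≟ˢ-σ w u) (≟ˢ-σ w v)
  ...   | inj₂ (eq , _) rewrite eq = trans (BoolP.∨-comm (σ w ≟ˢ σ v) _) (cong₂ _∨_ (≟ˢ-σ w u) (≟ˢ-σ w v))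
  τ-leq {x} {z} x∈ z∈ | edg∈ _ _ | bot∈   = refl
  τ-leq {x} {z} x∈ z∈ | edg∈ _ _ | vtx∈ _ = refl
  τ-leq {edg u v} {z} x∈ z∈ | edg∈ _ _ | edg∈ _ _ = ≡-from-true⇔true
    (λ τx≤τz → subst (λ y → leqG (edg u v) y ≡ true)
      (trans (sym (τ-involutive x∈)) (trans (cong τ (leqG-edg⇒≡ (τ z) τx≤τz)) (τ-involutive z∈)))
      (leqG-refl (edg u v)))
    (λ x≤z → subst (λ y → leqG (τ (edg u v)) (τ y) ≡ true) (leqG-edg⇒≡ z x≤z) (leqG-refl (τ (edg u v))))

  core⇒fixed : ∀ {x} → x ∈ P → core x ≡ true → τ x ≡ x
  core⇒fixed x∈ cx with ∈⇒InP x∈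
  ... | bot∈           = refl
  ... | vtx∈ {u} _     = cong vtx (sym (≟ˢ⇒≡ cx))
  ... | edg∈ {u} {v} uv∈ _ = trans
    (cong (E ∘ orient) (cong₂ _,_ (sym (≟ˢ⇒≡ (proj₁ (∧≡true⁻ cx)))) (sym (≟ˢ⇒≡ (proj₂ (∧≡true⁻ cx))))))
    (cong E (orient-id uv∈))

  bot⇒core : ∀ {x} → x ∈ P → isBotG x ≡ true → core x ≡ true
  bot⇒core {bot} _ _ = refl

  core-downward : ∀ {x z} → x ∈ P → z ∈ P → leqG x z ≡ true → core z ≡ true → core x ≡ true
  core-downward {bot}     _ _ _ _ = refl
  core-downward {vtx u} {vtx w} _ _ u≟w cw = subst (λ y → fixed y ≡ true) (sym (≟ˢ⇒≡ u≟w)) cw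
  core-downward {vtx u} {edg w w′} _ _ u≤ww′ cww′ with u ≟ˢ w in u≟w
  ... | true  = subst (λ y → fixed y ≡ true) (sym (≟ˢ⇒≡ u≟w)) (proj₁ (∧≡true⁻ cww′))
  ... | false = subst (λ y → fixed y ≡ true) (sym (≟ˢ⇒≡ u≤ww′)) (proj₂ (∧≡true⁻ cww′))
  core-downward {edg u v} {z} _ _ uv≤z cz = subst (λ y → core y ≡ true) (sym (leqG-edg⇒≡ z uv≤z)) cz

  noncore≰τ : ∀ {x} → x ∈ P → core x ≡ false → leqG x (τ x) ≡ false
  noncore≰τ x∈ cx with ∈⇒InP x∈
  ... | vtx∈ _ = cx
  ... | edg∈ {u} {v} uv∈ uv with σ-edge uv∈
  ...   | inj₁ (eq , _) rewrite eq = cx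
  ...   | inj₂ (eq , _) rewrite eq with v ≟ˢ σ u in v≟σu
  ...     | false = BoolP.∧-zeroʳ _
  ...     | true  = ⊥-elim (true≢false (begin
    true           ≡⟨ uv ⟨
    adj u v        ≡⟨ cong (adj u) (≟ˢ⇒≡ v≟σu) ⟩
    adj u (σ u)    ≡⟨ σ-nonadjacent (proj₁ (pairs-∈ vs uv∈)) ⟩
    false          ∎))
    where open ≡-Reasoning

  core-poset : filterᵇ core P ≡ graphPoset (filterᵇ fixed vs) adj
  core-poset = cong (bot ∷_) (begin
    filterᵇ core (map vtx vs ++ map E (filterᵇ isEdge (pairs vs)))
      ≡⟨ ListP.filter-++ (T? ∘ core) (map vtx vs) _ ⟩
    filterᵇ core (map vtx vs) ++ filterᵇ core (map E (filterᵇ isEdge (pairs vs)))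
      ≡⟨ cong₂ _++_ (filterᵇ-map core vtx vs) (filterᵇ-map core E (filterᵇ isEdge (pairs vs))) ⟩
    map vtx (filterᵇ fixed vs) ++ map E (filterᵇ bothFixed (filterᵇ isEdge (pairs vs)))
      ≡⟨ cong (λ es → map vtx (filterᵇ fixed vs) ++ map E es) edges ⟩
    map vtx (filterᵇ fixed vs) ++ map E (filterᵇ isEdge (pairs (filterᵇ fixed vs))) ∎)
    where
    open ≡-Reasoning
    bothFixed : Edge → Bool
    bothFixed (u , v) = fixed u ∧ fixed v
    edges : filterᵇ bothFixed (filterᵇ isEdge (pairs vs)) ≡ filterᵇ isEdge (pairs (filterᵇ fixed vs))
    edges = begin
      filterᵇ bothFixed (filterᵇ isEdge (pairs vs))
        ≡⟨ filterᵇ-filterᵇ bothFixed isEdge (pairs vs) ⟩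
      filterᵇ (λ e → isEdge e ∧ bothFixed e) (pairs vs)
        ≡⟨ filterᵇ-cong-local (pairs vs) (λ {e} _ → BoolP.∧-comm (isEdge e) _) ⟩
      filterᵇ (λ e → bothFixed e ∧ isEdge e) (pairs vs)
        ≡⟨ filterᵇ-filterᵇ isEdge bothFixed (pairs vs) ⟨
      filterᵇ isEdge (filterᵇ bothFixed (pairs vs))
        ≡⟨ cong (filterᵇ isEdge) (pairs-filterᵇ fixed vs) ⟨
      filterᵇ isEdge (pairs (filterᵇ fixed vs))
        ∎

  NimGraph-fixed : NimGraph vs adj ≡ NimGraph (filterᵇ fixed vs) adj
  NimGraph-fixed = trans Nim-core (cong (Chomp.Nim leqG isBotG) core-poset)
    where
    open ChompMirror leqG isBotG leqG-refl P τ core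
      τ-closed τ-involutive τ-leq core⇒fixed bot⇒core core-downward noncore≰τ

lemma2p7 : (n : ℕ) (l : ℤ) (k : ℕ) → k ≤ n →
    (inV : Subset n → Bool) →
    (t : ℕ) → 1 ≤ t → (b c : Fin t → Fin n) →
    Injective _≡_ _≡_ b → Injective _≡_ _≡_ c → (∀ i j → b i ≢ c j) →
    ((∀ u → InV k inV u → InV k inV (image (perm b c) u)) ×
     (∀ u → InV k inV u → ∃ λ w → InV k inV w × image (perm b c) w ≡ u)) →
    + t < + k - l →
    NimKG n k l inV ≡ NimKG n k l (λ u → inV u ∧ pairedᵇ b c u)
lemma2p7 n l k _ inV t _ b c b-injective c-injective b≢c (image-closed , _) t<k-l = begin
  NimGraph vs (adjKG l)                              ≡⟨ NimGraph-fixed ⟩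
  NimGraph (filterᵇ fixed vs) (adjKG l)              ≡⟨ cong (λ ws → NimGraph ws (adjKG l)) fixed≡paired ⟩
  NimGraph (vertsKG n k (λ u → inV u ∧ pairedᵇ b c u)) (adjKG l) ∎
  where
  open ≡-Reasoning
  open Transpositions b c b-injective c-injective b≢c
  vs = vertsKG n k inV
  open GraphMirror vs (adjKG l) (image π)
    (UniqueP.filter⁺ _ (allSubsets-unique n))
    (λ u∈ → ∈-vertsKG⁺ (image-closed _ (∈-vertsKG⁻ u∈)))
    image-involutive (adjKG-sym l) (adjKG-image l)
    (λ u∈ → image-nonadjacent l (proj₁ (∈-vertsKG⁻ u∈)) t<k-l)
  fixed≡paired : filterᵇ fixed vs ≡ vertsKG n k (λ u → inV u ∧ pairedᵇ b c u)
  fixed≡paired = sym (trans (vertsKG-∧ n k inV (pairedᵇ b c))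
    (filterᵇ-cong-local vs λ {u} _ → pairedᵇ≡fixed u))
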